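{- Let $P$ and $Q$ be lattice paths from $(0,0)$ to $(m,r)$, $n=m+r$, with $P$ never above $Q$ and meeting $Q$ only at $(0,0)$ and $(m,r)$, and let $M=M[P,Q]$. Let $A$ be an initial connected flat and $B$ a final connected flat of $M$. Then the pair $(A,B)$ is modular if and only if it is not mixed.
   Context: A lattice path is a word $p_1\cdots p_n$ in the letters $N$ (unit step north) and $E$ (unit step east), read as a path starting at $(0,0)$. For lattice paths $P=p_1\cdots p_n$, $Q=q_1\cdots q_n$ from $(0,0)$ to $(m,r)$ with $P$ never above $Q$, let $p_{u_1},\ldots,p_{u_r}$ ($u_1<\cdots<u_r$) be the north steps of $P$ and $q_{l_1},\ldots,q_{l_r}$ ($l_1<\cdots<l_r$) those of $Q$, and set $N_i=\{l_i,\ldots,u_i\}$. $M[P,Q]$ is the transversal matroid on $[n]$ whose independent sets are the partial transversals of $(N_1,\ldots,N_r)$. An initial connected flat is an interval $A=[a]$ such that $q_a=E$, $q_{a+1}=N$; the point $(a_1,a_2)$ where these two steps meet (so $a_1+a_2=a$) is its corner. A final connected flat is an interval $B=[b,n]$ such that $p_{b-1}=N$, $p_b=E$; the point $(b_1,b_2)$ where these two steps meet (so $b_1+b_2=b-1$) is its corner. The pair $(A,B)$ is mixed if $a_1<b_1$ and $a_2>b_2$. A pair $(X,Y)$ is modular if $r(X)+r(Y)=r(X\cup Y)+r(X\cap Y)$. -}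

module Defs where

open import Data.Nat using (ℕ; zero; suc; _+_; _≤_; _<_; _∸_; _≤ᵇ_)
open import Data.List using (List; []; _∷_; take; length)
open import Data.Maybe using (Maybe; just; nothing)
open import Data.Fin using (Fin; toℕ)
open import Data.Fin.Subset using (Subset; _∈_; _⊆_; _∪_; _∩_; ∣_∣)
open import Data.Vec using (tabulate)
open import Data.Product using (Σ; ∃; _×_)
open import Relation.Binary.PropositionalEquality using (_≡_)

data Step : Set where
  N E : Step

-- 1-based lookup: nth L p = p-th step of L (nothing if out of range).
nth : List Step → ℕ → Maybe Step
nth []       _             = nothing
nth (_ ∷ _)  zero          = nothing
nth (s ∷ _)  (suc zero)    = just s
nth (_ ∷ xs) (suc (suc k)) = nth xs (suc k)

countN : List Step → ℕ
countN []       = 0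
countN (N ∷ xs) = suc (countN xs)
countN (E ∷ xs) = countN xs

countE : List Step → ℕ
countE []       = 0
countE (N ∷ xs) = countE xs
countE (E ∷ xs) = suc (countE xs)

IsPath : ℕ → ℕ → List Step → Set
IsPath m r L = countE L ≡ m × countN L ≡ r

NeverAbove : List Step → List Step → Set
NeverAbove P Q = ∀ k → countN (take k P) ≤ countN (take k Q)

-- P and Q meet only at the endpoints (a common point is reached after the
-- same number k of steps; interior points: 0 < k < length).
MeetOnlyAtEnds : List Step → List Step → Set
MeetOnlyAtEnds P Q = ∀ k → 0 < k → k < length P → countN (take k P) < countN (take k Q)

-- p (1-based) is the position of the i-th north step of L.
IsNthN : List Step → ℕ → ℕ → Set
IsNthN L i p = nth L p ≡ just N × countN (take p L) ≡ i

-- x ∈ N_i = {l_i, …, u_i}  (x, i 1-based)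
InN : List Step → List Step → ℕ → ℕ → Set
InN P Q i x = ∃ λ l → ∃ λ u → IsNthN Q i l × IsNthN P i u × l ≤ x × x ≤ u

-- Ground set [n] is represented by Fin n, element x ↦ paper element toℕ x + 1.
-- Partial transversals of (N_1,…,N_r): there is an injective assignment of
-- each element of I to an index j : Fin r (paper index toℕ j + 1) with x ∈ N_j.
Independent : (n r : ℕ) → List Step → List Step → Subset n → Set
Independent n r P Q I =
  Σ ((x : Fin n) → x ∈ I → Fin r) λ f →
    ((x : Fin n) (h : x ∈ I) → InN P Q (suc (toℕ (f x h))) (suc (toℕ x))) ×
    ((x y : Fin n) (hx : x ∈ I) (hy : y ∈ I) → f x hx ≡ f y hy → x ≡ y)

IsRank : (n r : ℕ) → List Step → List Step → Subset n → ℕ → Set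
IsRank n r P Q X k =
  (∃ λ I → I ⊆ X × Independent n r P Q I × ∣ I ∣ ≡ k) ×
  (∀ I → I ⊆ X → Independent n r P Q I → ∣ I ∣ ≤ k)

Modular : (n r : ℕ) → List Step → List Step → Subset n → Subset n → Set
Modular n r P Q X Y = ∀ a b c d →
  IsRank n r P Q X a → IsRank n r P Q Y b →
  IsRank n r P Q (X ∪ Y) c → IsRank n r P Q (X ∩ Y) d → a + b ≡ c + d

-- Initial connected flat [a]: q_a = E, q_{a+1} = N.
InitialCF : List Step → ℕ → Set
InitialCF Q a = nth Q a ≡ just E × nth Q (suc a) ≡ just N

-- Final connected flat [b,n]: p_{b-1} = N, p_b = E   (b ≥ 2 forced).
FinalCF : List Step → ℕ → Set
FinalCF P b = Σ ℕ λ b' → b ≡ suc b' × nth P b' ≡ just N × nth P b ≡ just E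

initSet : (n a : ℕ) → Subset n
initSet n a = tabulate (λ x → suc (toℕ x) ≤ᵇ a)

finalSet : (n b : ℕ) → Subset n
finalSet n b = tabulate (λ x → b ≤ᵇ suc (toℕ x))

-- Corners: A's corner = (#E, #N) in the first a steps of Q;
-- B's corner = (#E, #N) in the first b-1 steps of P.
-- Mixed: a₁ < b₁ and a₂ > b₂.
Mixed : List Step → List Step → ℕ → ℕ → Set
Mixed P Q a b =
  countE (take a Q) < countE (take (b ∸ 1) P) × countN (take (b ∸ 1) P) < countN (take a Q)

{-# OPTIONS --safe #-}
-- Let lo i and hi i be the 0-based positions of the north steps numbered i (from 0) of Q and P,
-- so that N_(i+1) = [lo i, hi i], with lo ≤ hi and both strictly increasing. For an interval
-- [u, v) of elements, the sets meeting it are the N_(i+1) with c ≤ i < d, where c counts the north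
-- steps of P before u and d those of Q before v; representing N_(c+t+1) by max(lo (c + t), u + t)
-- shows that the interval has rank min(d − c, v − u). With corners (a₁, a₂) of A = [0, a) and
-- (b₁, b₂) of B = [b', n), b' = b − 1, this gives r(A) = a₂, r(B) = r − b₂ and
-- r(A ∩ B) = min(a₂ − b₂, a − b'). Moreover r(A ∪ B) = min(b₂, a₂) + (r − b₂): it is at most r
-- and at most r(A) + r(B), and a matching of that size is glued from one inside A and one inside B.
-- So modularity says a₂ − b₂ ≤ (a₁ + a₂) − (b₁ + b₂), which fails exactly when a₁ < b₁ and b₂ < a₂.
module Submission where

open import Defs
open import Data.Bool using (Bool; T)
open import Data.Bool.Properties using (T-≡)
open import Data.Empty using (⊥-elim)
open import Data.Fin using (Fin; zero; suc; toℕ; fromℕ<; splitAt; join)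
import Data.Fin.Properties as Finₚ
open Finₚ using (toℕ-injective; toℕ<n; toℕ-fromℕ<; join-splitAt)
open import Data.Fin.Subset
  using (Subset; _∈_; _∉_; _⊆_; _∪_; _∩_; ∣_∣; ⊥; ⊤; ⁅_⁆; _-_; Empty; inside; outside)
open import Data.Fin.Subset.Properties
  using (∉⊥; ∈⊤; ∣⊥∣≡0; ∣⊤∣≡n; ∣⁅x⁆∣≡1; x∈⁅y⁆⇒x≡y; Empty-unique; p⊆q⇒∣p∣≤∣q∣; x∈p⇒∣p-x∣<∣p∣;
         x∈p∧x≢y⇒x∈p-y; x∈p∪q⁺; x∈p∪q⁻; x∈p∩q⁺; x∈p∩q⁻; p∩q⊆p; p∩q⊆q)
open import Data.List using (List; []; _∷_; take; length)
open import Data.List.Properties using (take-all)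
open import Data.Maybe using (just)
open import Data.Nat
  using (ℕ; zero; suc; _+_; _∸_; _⊓_; _⊔_; _≤_; _<_; _≤ᵇ_; z≤n; s≤s; s≤s⁻¹; _<?_; _≤?_)
open import Data.Nat.Properties
open import Data.Product using (Σ; ∃; _×_; _,_; proj₁; proj₂)
open import Data.Sum using (inj₁; inj₂; [_,_]′)
open import Data.Vec using ([]; _∷_; here; there; tabulate)
open import Data.Vec.Properties using (lookup∘tabulate; []=⇒lookup; lookup⇒[]=)
open import Function using (_∘_)
open import Function.Bundles using (_⇔_; mk⇔; Equivalence)
open import Function.Definitions using (Injective)
open import Function.Properties.Equivalence using () renaming (trans to ⇔-trans)
open import Relation.Nullary using (¬_; yes; no; contradiction)
open import Relation.Binary.PropositionalEquality
open import Relation.Binary.Definitions using (tri<; tri≈; tri>)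

-- posN L i is the 0-based position of the north step of L numbered i from 0. Past the last
-- north step it keeps counting up (junk), which makes posN L strictly increasing everywhere.
posN : List Step → ℕ → ℕ
posN []      i       = i
posN (N ∷ L) zero    = zero
posN (N ∷ L) (suc i) = suc (posN L i)
posN (E ∷ L) i       = suc (posN L i)

posN-step : ∀ L i → posN L i < posN L (suc i)
posN-step []      i       = ≤-refl
posN-step (N ∷ L) zero    = s≤s z≤n
posN-step (N ∷ L) (suc i) = s≤s (posN-step L i)
posN-step (E ∷ L) i       = s≤s (posN-step L i)

module StrictlyIncreasing {f : ℕ → ℕ} (f-step : ∀ i → f i < f (suc i)) where

  <-mono : ∀ {i j} → i < j → f i < f j
  <-mono {i} {suc j} (s≤s i≤j) with m≤n⇒m<n∨m≡n i≤j
  ... | inj₁ i<j  = <-trans (<-mono i<j) (f-step j)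
  ... | inj₂ refl = f-step i

  +-≤ : ∀ i t → f i + t ≤ f (i + t)
  +-≤ i zero    = ≤-reflexive (trans (+-identityʳ (f i)) (cong f (sym (+-identityʳ i))))
  +-≤ i (suc t) = begin
    f i + suc t     ≡⟨ +-suc (f i) t ⟩
    suc (f i + t)   ≤⟨ s≤s (+-≤ i t) ⟩
    suc (f (i + t)) ≤⟨ f-step (i + t) ⟩
    f (suc (i + t)) ≡⟨ cong f (+-suc i t) ⟨
    f (i + suc t)   ∎
    where open ≤-Reasoning

  injective : ∀ {i j} → f i ≡ f j → i ≡ j
  injective {i} {j} fi≡fj with <-cmp i j
  ... | tri< i<j _ _ = contradiction fi≡fj (<⇒≢ (<-mono i<j))
  ... | tri≈ _ i≡j _ = i≡j
  ... | tri> _ _ j<i = contradiction (sym fi≡fj) (<⇒≢ (<-mono j<i))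

<countN-take⇒posN< : ∀ L {i} p → i < countN (take p L) → posN L i < p
<countN-take⇒posN< []      {i}     zero    ()
<countN-take⇒posN< []      {i}     (suc p) ()
<countN-take⇒posN< (_ ∷ L) {i}     zero    ()
<countN-take⇒posN< (N ∷ L) {zero}  (suc p) _         = s≤s z≤n
<countN-take⇒posN< (N ∷ L) {suc i} (suc p) (s≤s i<) = s≤s (<countN-take⇒posN< L p i<)
<countN-take⇒posN< (E ∷ L) {i}     (suc p) i<       = s≤s (<countN-take⇒posN< L p i<)

countN-take≤⇒≤posN : ∀ L {i} p → countN (take p L) ≤ i → i < countN L → p ≤ posN L i
countN-take≤⇒≤posN (_ ∷ L) {i}     zero    _          _         = z≤n
countN-take≤⇒≤posN (N ∷ L) {zero}  (suc p) ()         _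
countN-take≤⇒≤posN (N ∷ L) {suc i} (suc p) (s≤s ≤i) (s≤s i<) = s≤s (countN-take≤⇒≤posN L p ≤i i<)
countN-take≤⇒≤posN (E ∷ L) {i}     (suc p) ≤i        i<       = s≤s (countN-take≤⇒≤posN L p ≤i i<)

countN-take-posN : ∀ L {i} → i < countN L → countN (take (posN L i) L) ≡ i
countN-take-posN (N ∷ L) {zero}  _        = refl
countN-take-posN (N ∷ L) {suc i} (s≤s i<) = cong suc (countN-take-posN L i<)
countN-take-posN (E ∷ L) {i}     i<       = countN-take-posN L i<

nth≡N⇒countN-take-suc : ∀ L k → nth L (suc k) ≡ just N →
  countN (take (suc k) L) ≡ suc (countN (take k L))
nth≡N⇒countN-take-suc (N ∷ L) zero    _  = refl
nth≡N⇒countN-take-suc (N ∷ L) (suc k) eq = cong suc (nth≡N⇒countN-take-suc L k eq)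
nth≡N⇒countN-take-suc (E ∷ L) (suc k) eq = nth≡N⇒countN-take-suc L k eq

nth≡N⇒posN-countN-take : ∀ L k → nth L (suc k) ≡ just N → posN L (countN (take k L)) ≡ k
nth≡N⇒posN-countN-take (N ∷ L) zero    _  = refl
nth≡N⇒posN-countN-take (N ∷ L) (suc k) eq = cong suc (nth≡N⇒posN-countN-take L k eq)
nth≡N⇒posN-countN-take (E ∷ L) (suc k) eq = cong suc (nth≡N⇒posN-countN-take L k eq)

IsNthN-posN : ∀ L {i} → i < countN L → IsNthN L (suc i) (suc (posN L i))
IsNthN-posN (N ∷ L) {zero}  _        = refl , refl
IsNthN-posN (N ∷ L) {suc i} (s≤s i<) = proj₁ (IsNthN-posN L i<) , cong suc (proj₂ (IsNthN-posN L i<))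
IsNthN-posN (E ∷ L) {i}     i<       = IsNthN-posN L i<

IsNthN⇒≡suc-posN : ∀ L {i l} → IsNthN L (suc i) l → l ≡ suc (posN L i)
IsNthN⇒≡suc-posN []      {l = zero}  (() , _)
IsNthN⇒≡suc-posN []      {l = suc k} (() , _)
IsNthN⇒≡suc-posN (_ ∷ L) {l = zero}  (() , _)
IsNthN⇒≡suc-posN L {i} {suc k} (isN , count) = cong suc (begin
  k                            ≡⟨ nth≡N⇒posN-countN-take L k isN ⟨
  posN L (countN (take k L))   ≡⟨ cong (posN L) (suc-injective countN-take-k≡i) ⟩
  posN L i                     ∎)
  where
  open ≡-Reasoning
  countN-take-k≡i = trans (sym (nth≡N⇒countN-take-suc L k isN)) count

countN-take≤countN : ∀ L k → countN (take k L) ≤ countN L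
countN-take≤countN L       zero    = z≤n
countN-take≤countN []      (suc k) = z≤n
countN-take≤countN (N ∷ L) (suc k) = s≤s (countN-take≤countN L k)
countN-take≤countN (E ∷ L) (suc k) = countN-take≤countN L k

countN-take≤ : ∀ L k → countN (take k L) ≤ k
countN-take≤ L       zero    = z≤n
countN-take≤ []      (suc k) = z≤n
countN-take≤ (N ∷ L) (suc k) = s≤s (countN-take≤ L k)
countN-take≤ (E ∷ L) (suc k) = m≤n⇒m≤1+n (countN-take≤ L k)

countN∸countN-take≤length∸ : ∀ L k → countN L ∸ countN (take k L) ≤ length L ∸ k
countN∸countN-take≤length∸ []      zero    = z≤n
countN∸countN-take≤length∸ []      (suc k) = z≤n
countN∸countN-take≤length∸ (N ∷ L) zero    = s≤s (countN∸countN-take≤length∸ L zero)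
countN∸countN-take≤length∸ (E ∷ L) zero    = m≤n⇒m≤1+n (countN∸countN-take≤length∸ L zero)
countN∸countN-take≤length∸ (N ∷ L) (suc k) = countN∸countN-take≤length∸ L k
countN∸countN-take≤length∸ (E ∷ L) (suc k) = countN∸countN-take≤length∸ L k

countE+countN-take : ∀ L k → k ≤ length L → countE (take k L) + countN (take k L) ≡ k
countE+countN-take L       zero    _        = refl
countE+countN-take (N ∷ L) (suc k) (s≤s k≤) = trans (+-suc _ _) (cong suc (countE+countN-take L k k≤))
countE+countN-take (E ∷ L) (suc k) (s≤s k≤) = cong suc (countE+countN-take L k k≤)

length≡countE+countN : ∀ L → length L ≡ countE L + countN L
length≡countE+countN []      = refl
length≡countE+countN (N ∷ L) =
  trans (cong suc (length≡countE+countN L)) (sym (+-suc (countE L) (countN L)))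
length≡countE+countN (E ∷ L) = cong suc (length≡countE+countN L)

nth≡just⇒≤length : ∀ L k {s} → nth L k ≡ just s → k ≤ length L
nth≡just⇒≤length L       zero          _  = z≤n
nth≡just⇒≤length (_ ∷ L) (suc zero)    _  = s≤s z≤n
nth≡just⇒≤length (_ ∷ L) (suc (suc k)) eq = s≤s (nth≡just⇒≤length L (suc k) eq)

∣p∪q∣+∣p∩q∣≡∣p∣+∣q∣ : ∀ {n} (p q : Subset n) → ∣ p ∪ q ∣ + ∣ p ∩ q ∣ ≡ ∣ p ∣ + ∣ q ∣
∣p∪q∣+∣p∩q∣≡∣p∣+∣q∣ []            []            = refl
∣p∪q∣+∣p∩q∣≡∣p∣+∣q∣ (inside  ∷ p) (inside  ∷ q) =
  cong suc (trans (+-suc _ _) (trans (cong suc (∣p∪q∣+∣p∩q∣≡∣p∣+∣q∣ p q)) (sym (+-suc _ _))))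
∣p∪q∣+∣p∩q∣≡∣p∣+∣q∣ (inside  ∷ p) (outside ∷ q) = cong suc (∣p∪q∣+∣p∩q∣≡∣p∣+∣q∣ p q)
∣p∪q∣+∣p∩q∣≡∣p∣+∣q∣ (outside ∷ p) (inside  ∷ q) =
  trans (cong suc (∣p∪q∣+∣p∩q∣≡∣p∣+∣q∣ p q)) (sym (+-suc _ _))
∣p∪q∣+∣p∩q∣≡∣p∣+∣q∣ (outside ∷ p) (outside ∷ q) = ∣p∪q∣+∣p∩q∣≡∣p∣+∣q∣ p q

∣p∪q∣≤∣p∣+∣q∣ : ∀ {n} (p q : Subset n) → ∣ p ∪ q ∣ ≤ ∣ p ∣ + ∣ q ∣
∣p∪q∣≤∣p∣+∣q∣ p q = ≤-trans (m≤m+n _ _) (≤-reflexive (∣p∪q∣+∣p∩q∣≡∣p∣+∣q∣ p q))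

Empty[p∩q]⇒∣p∪q∣≡∣p∣+∣q∣ : ∀ {n} (p q : Subset n) → Empty (p ∩ q) → ∣ p ∪ q ∣ ≡ ∣ p ∣ + ∣ q ∣
Empty[p∩q]⇒∣p∪q∣≡∣p∣+∣q∣ {n} p q empty = begin
  ∣ p ∪ q ∣             ≡⟨ +-identityʳ _ ⟨
  ∣ p ∪ q ∣ + 0         ≡⟨ cong (∣ p ∪ q ∣ +_) (∣⊥∣≡0 n) ⟨
  ∣ p ∪ q ∣ + ∣ ⊥ {n} ∣ ≡⟨ cong (λ s → ∣ p ∪ q ∣ + ∣ s ∣) (Empty-unique empty) ⟨
  ∣ p ∪ q ∣ + ∣ p ∩ q ∣ ≡⟨ ∣p∪q∣+∣p∩q∣≡∣p∣+∣q∣ p q ⟩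
  ∣ p ∣ + ∣ q ∣         ∎
  where open ≡-Reasoning

injection⇒∣p∣≤∣q∣ : ∀ {n k} (p : Subset n) (q : Subset k) (g : ∀ x → x ∈ p → Fin k) →
  (∀ x h → g x h ∈ q) → (∀ x y hx hy → g x hx ≡ g y hy → x ≡ y) → ∣ p ∣ ≤ ∣ q ∣
injection⇒∣p∣≤∣q∣ []            q g g∈q g-inj = z≤n
injection⇒∣p∣≤∣q∣ (outside ∷ p) q g g∈q g-inj =
  injection⇒∣p∣≤∣q∣ p q (λ x h → g (suc x) (there h)) (λ x h → g∈q (suc x) (there h))
    (λ x y hx hy → Finₚ.suc-injective ∘ g-inj (suc x) (suc y) (there hx) (there hy))
injection⇒∣p∣≤∣q∣ (inside ∷ p)  q g g∈q g-inj = begin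
  suc ∣ p ∣               ≤⟨ s≤s (injection⇒∣p∣≤∣q∣ p (q - g₀) (λ x h → g (suc x) (there h)) ∈q-g₀
                               (λ x y hx hy → Finₚ.suc-injective ∘
                                              g-inj (suc x) (suc y) (there hx) (there hy))) ⟩
  suc ∣ q - g₀ ∣          ≤⟨ x∈p⇒∣p-x∣<∣p∣ (g∈q zero here) ⟩
  ∣ q ∣                   ∎
  where
  open ≤-Reasoning
  g₀ = g zero here
  ∈q-g₀ : ∀ x h → g (suc x) (there h) ∈ q - g₀
  ∈q-g₀ x h = x∈p∧x≢y⇒x∈p-y (g∈q (suc x) (there h))
                             (Finₚ.0≢1+n ∘ sym ∘ g-inj (suc x) zero (there h) here)

interval-injection⇒∣p∣≤ : ∀ {n} (p : Subset n) {u v} (g : ∀ x → x ∈ p → ℕ) →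
  (∀ x h → u ≤ g x h × g x h < v) → (∀ x y hx hy → g x hx ≡ g y hy → x ≡ y) → ∣ p ∣ ≤ v ∸ u
interval-injection⇒∣p∣≤ p {u} {v} g g-bounds g-inj =
  subst (∣ p ∣ ≤_) (∣⊤∣≡n (v ∸ u)) (injection⇒∣p∣≤∣q∣ p ⊤ shifted (λ _ _ → ∈⊤) shifted-inj)
  where
  shifted : ∀ x → x ∈ p → Fin (v ∸ u)
  shifted x h = fromℕ< (∸-monoˡ-< (proj₂ (g-bounds x h)) (proj₁ (g-bounds x h)))
  shifted-inj : ∀ x y hx hy → shifted x hx ≡ shifted y hy → x ≡ y
  shifted-inj x y hx hy eq = g-inj x y hx hy (∸-cancelʳ-≡ (proj₁ (g-bounds x hx)) (proj₁ (g-bounds y hy))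
    (trans (sym (toℕ-fromℕ< _)) (trans (cong toℕ eq) (toℕ-fromℕ< _))))

image-of-injection : ∀ {K n} (e : Fin K → Fin n) → Injective _≡_ _≡_ e →
  Σ (Subset n) λ I → ∣ I ∣ ≡ K × (∀ {x} → x ∈ I → ∃ λ t → e t ≡ x)
image-of-injection {zero}  {n} e _ = ⊥ , ∣⊥∣≡0 n , λ h → ⊥-elim (∉⊥ h)
image-of-injection {suc K}     e e-inj = ⁅ e zero ⁆ ∪ I , card , preimage
  where
  rest = image-of-injection (e ∘ suc) (Finₚ.suc-injective ∘ e-inj)
  I = proj₁ rest
  e₀∉I : e zero ∉ I
  e₀∉I h = Finₚ.0≢1+n (sym (e-inj (proj₂ (proj₂ (proj₂ rest) h))))
  card : ∣ ⁅ e zero ⁆ ∪ I ∣ ≡ suc K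
  card = begin
    ∣ ⁅ e zero ⁆ ∪ I ∣     ≡⟨ Empty[p∩q]⇒∣p∪q∣≡∣p∣+∣q∣ ⁅ e zero ⁆ I disjoint ⟩
    ∣ ⁅ e zero ⁆ ∣ + ∣ I ∣ ≡⟨ cong₂ _+_ (∣⁅x⁆∣≡1 (e zero)) (proj₁ (proj₂ rest)) ⟩
    suc K                  ∎
    where
    open ≡-Reasoning
    disjoint : Empty (⁅ e zero ⁆ ∩ I)
    disjoint (x , h) with x∈p∩q⁻ ⁅ e zero ⁆ I h
    ... | x∈⁅e₀⁆ , x∈I = e₀∉I (subst (_∈ I) (x∈⁅y⁆⇒x≡y (e zero) x∈⁅e₀⁆) x∈I)
  preimage : ∀ {x} → x ∈ ⁅ e zero ⁆ ∪ I → ∃ λ t → e t ≡ x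
  preimage {x} h with x∈p∪q⁻ ⁅ e zero ⁆ I h
  ... | inj₁ x∈⁅e₀⁆ = zero , sym (x∈⁅y⁆⇒x≡y (e zero) x∈⁅e₀⁆)
  ... | inj₂ x∈I    with proj₂ (proj₂ rest) x∈I
  ...   | t , eq = suc t , eq

<∸⇒+< : ∀ c {t d} → t < d ∸ c → c + t < d
<∸⇒+< zero             t<d     = t<d
<∸⇒+< (suc c) {d = suc d} t<d∸c = s≤s (<∸⇒+< c t<d∸c)

[,]∘splitAt-injective : ∀ K {L} {A : Set} {f : Fin K → A} {g : Fin L → A} →
  Injective _≡_ _≡_ f → Injective _≡_ _≡_ g → (∀ s t → f s ≢ g t) →
  Injective _≡_ _≡_ ([ f , g ]′ ∘ splitAt K)
[,]∘splitAt-injective K {L} {f = f} {g} f-inj g-inj f≢g {i} {j} eq = begin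
  i                      ≡⟨ join-splitAt K L i ⟨
  join K L (splitAt K i) ≡⟨ cong (join K L) ([,]-injective (splitAt K i) (splitAt K j) eq) ⟩
  join K L (splitAt K j) ≡⟨ join-splitAt K L j ⟩
  j                      ∎
  where
  open ≡-Reasoning
  [,]-injective : ∀ x y → [ f , g ]′ x ≡ [ f , g ]′ y → x ≡ y
  [,]-injective (inj₁ s) (inj₁ t) fs≡ft = cong inj₁ (f-inj fs≡ft)
  [,]-injective (inj₁ s) (inj₂ t) fs≡gt = contradiction fs≡gt (f≢g s t)
  [,]-injective (inj₂ s) (inj₁ t) gs≡ft = contradiction (sym gs≡ft) (f≢g t s)
  [,]-injective (inj₂ s) (inj₂ t) gs≡gt = cong inj₂ (g-inj gs≡gt)

∈tabulate⇔ : ∀ {n} (f : Fin n → Bool) x → x ∈ tabulate f ⇔ T (f x)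
∈tabulate⇔ f x = mk⇔
  (λ x∈ → Equivalence.from T-≡ (trans (sym (lookup∘tabulate f x)) ([]=⇒lookup x∈)))
  (λ fx → lookup⇒[]= x (tabulate f) (trans (lookup∘tabulate f x) (Equivalence.to T-≡ fx)))

T[≤ᵇ]⇔≤ : ∀ {m n} → T (m ≤ᵇ n) ⇔ m ≤ n
T[≤ᵇ]⇔≤ {m} {n} = mk⇔ (≤ᵇ⇒≤ m n) ≤⇒≤ᵇ

IsPath⇒length≡ : ∀ {m r} L → IsPath m r L → length L ≡ m + r
IsPath⇒length≡ L (#E≡m , #N≡r) = trans (length≡countE+countN L) (cong₂ _+_ #E≡m #N≡r)

InN-intro : ∀ P Q {i x} → i < countN Q → i < countN P → posN Q i ≤ x → x ≤ posN P i →
  InN P Q (suc i) (suc x)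
InN-intro P Q i<#Q i<#P lo≤x x≤hi =
  suc (posN Q _) , suc (posN P _) , IsNthN-posN Q i<#Q , IsNthN-posN P i<#P , s≤s lo≤x , s≤s x≤hi

InN-elim : ∀ P Q {i x} → InN P Q (suc i) (suc x) → posN Q i ≤ x × x ≤ posN P i
InN-elim P Q {x = x} (l , u , l-isN , u-isN , l≤x , x≤u) =
  s≤s⁻¹ (subst (_≤ suc x) (IsNthN⇒≡suc-posN Q l-isN) l≤x) ,
  s≤s⁻¹ (subst (suc x ≤_) (IsNthN⇒≡suc-posN P u-isN) x≤u)

InN⇒< : ∀ P Q {j x} u → InN P Q (suc j) (suc x) → j < countN (take u P) → x < u
InN⇒< P Q u inN j< = ≤-<-trans (proj₂ (InN-elim P Q inN)) (<countN-take⇒posN< P u j<)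

InN⇒<countN-take : ∀ P Q {j x} v → InN P Q (suc j) (suc x) → j < countN Q → x < v →
  j < countN (take v Q)
InN⇒<countN-take P Q v inN j<#Q x<v =
  ≰⇒> (λ #≤j → <⇒≱ x<v (≤-trans (countN-take≤⇒≤posN Q v #≤j j<#Q) (proj₁ (InN-elim P Q inN))))

module TransversalMatroid {n r : ℕ} (P Q : List Step) where

  RankAtMost : Subset n → ℕ → Set
  RankAtMost X k = ∀ I → I ⊆ X → Independent n r P Q I → ∣ I ∣ ≤ k

  rank-unique : ∀ {X k l} → IsRank n r P Q X k → IsRank n r P Q X l → k ≡ l
  rank-unique ((I , I⊆X , I-ind , ∣I∣≡k) , ≤k) ((J , J⊆X , J-ind , ∣J∣≡l) , ≤l) =
    ≤-antisym (subst (_≤ _) ∣I∣≡k (≤l I I⊆X I-ind)) (subst (_≤ _) ∣J∣≡l (≤k J J⊆X J-ind))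

  modular⇔ : ∀ {X Y a b c d} → IsRank n r P Q X a → IsRank n r P Q Y b →
    IsRank n r P Q (X ∪ Y) c → IsRank n r P Q (X ∩ Y) d → Modular n r P Q X Y ⇔ (a + b ≡ c + d)
  modular⇔ rX rY rX∪Y rX∩Y = mk⇔
    (λ modular → modular _ _ _ _ rX rY rX∪Y rX∩Y)
    (λ eq _ _ _ _ rX′ rY′ rX∪Y′ rX∩Y′ →
      subst₂ _≡_ (cong₂ _+_ (rank-unique rX rX′) (rank-unique rY rY′))
                 (cong₂ _+_ (rank-unique rX∪Y rX∪Y′) (rank-unique rX∩Y rX∩Y′)) eq)

  independent-⊆ : ∀ {I J} → I ⊆ J → Independent n r P Q J → Independent n r P Q I
  independent-⊆ I⊆J (f , f∈N , f-inj) =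
    (λ x h → f x (I⊆J h)) , (λ x h → f∈N x (I⊆J h)) , (λ x y hx hy → f-inj x y (I⊆J hx) (I⊆J hy))

  RankAtMost-∪ : ∀ {X Y k l} → RankAtMost X k → RankAtMost Y l → RankAtMost (X ∪ Y) (k + l)
  RankAtMost-∪ {X} {Y} {k} {l} ≤k ≤l I I⊆X∪Y I-ind = begin
    ∣ I ∣                     ≤⟨ p⊆q⇒∣p∣≤∣q∣ I⊆[I∩X]∪[I∩Y] ⟩
    ∣ (I ∩ X) ∪ (I ∩ Y) ∣     ≤⟨ ∣p∪q∣≤∣p∣+∣q∣ (I ∩ X) (I ∩ Y) ⟩
    ∣ I ∩ X ∣ + ∣ I ∩ Y ∣     ≤⟨ +-mono-≤ (≤k (I ∩ X) (p∩q⊆q I X) (independent-⊆ (p∩q⊆p I X) I-ind))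
                                          (≤l (I ∩ Y) (p∩q⊆q I Y) (independent-⊆ (p∩q⊆p I Y) I-ind)) ⟩
    k + l                     ∎
    where
    open ≤-Reasoning
    I⊆[I∩X]∪[I∩Y] : I ⊆ (I ∩ X) ∪ (I ∩ Y)
    I⊆[I∩X]∪[I∩Y] x∈I with x∈p∪q⁻ X Y (I⊆X∪Y x∈I)
    ... | inj₁ x∈X = x∈p∪q⁺ (inj₁ (x∈p∩q⁺ (x∈I , x∈X)))
    ... | inj₂ x∈Y = x∈p∪q⁺ (inj₂ (x∈p∩q⁺ (x∈I , x∈Y)))

  RankAtMost-⊓ : ∀ {X k l} → RankAtMost X k → RankAtMost X l → RankAtMost X (k ⊓ l)
  RankAtMost-⊓ ≤k ≤l I I⊆X I-ind = ⊓-glb (≤k I I⊆X I-ind) (≤l I I⊆X I-ind)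

  RankAtMost-indices : ∀ {X c d} →
    (∀ {x j} → x ∈ X → InN P Q (suc (toℕ j)) (suc (toℕ x)) → c ≤ toℕ j × toℕ j < d) →
    RankAtMost X (d ∸ c)
  RankAtMost-indices region I I⊆X (f , f∈N , f-inj) =
    interval-injection⇒∣p∣≤ I (λ x h → toℕ (f x h)) (λ x h → region (I⊆X h) (f∈N x h))
      (λ x y hx hy → f-inj x y hx hy ∘ toℕ-injective)

  RankAtMost-r : ∀ {X} → RankAtMost X r
  RankAtMost-r = RankAtMost-indices (λ {_} {j} _ _ → z≤n , toℕ<n j)

  RankAtMost-elements : ∀ {X u v} → (∀ {x} → x ∈ X → u ≤ toℕ x × toℕ x < v) → RankAtMost X (v ∸ u)
  RankAtMost-elements bounds I I⊆X _ =
    interval-injection⇒∣p∣≤ I (λ x _ → toℕ x) (λ x h → bounds (I⊆X h)) (λ x y _ _ → toℕ-injective)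

  record Transversal (K : ℕ) (X : Subset n) : Set where
    field
      index             : Fin K → Fin r
      element           : Fin K → Fin n
      index-injective   : Injective _≡_ _≡_ index
      element-injective : Injective _≡_ _≡_ element
      element∈X         : ∀ t → element t ∈ X
      element∈N         : ∀ t → InN P Q (suc (toℕ (index t))) (suc (toℕ (element t)))

  open Transversal public

  transversal-∪ : ∀ {K L X Y} (T : Transversal K X) (U : Transversal L Y) →
    (∀ s t → index T s ≢ index U t) → (∀ s t → element T s ≢ element U t) →
    Transversal (K + L) (X ∪ Y)
  transversal-∪ {K} {L} {X} {Y} T U index-disjoint element-disjoint = record
    { index             = [ index T , index U ]′ ∘ splitAt K
    ; element           = [ element T , element U ]′ ∘ splitAt K
    ; index-injective   = [,]∘splitAt-injective K (index-injective T) (index-injective U) index-disjoint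
    ; element-injective =
        [,]∘splitAt-injective K (element-injective T) (element-injective U) element-disjoint
    ; element∈X         = ∈X∪Y
    ; element∈N         = ∈N
    }
    where
    ∈X∪Y : ∀ t → [ element T , element U ]′ (splitAt K t) ∈ X ∪ Y
    ∈X∪Y t with splitAt K t
    ... | inj₁ s = x∈p∪q⁺ (inj₁ (element∈X T s))
    ... | inj₂ s = x∈p∪q⁺ (inj₂ (element∈X U s))
    ∈N : ∀ t → InN P Q (suc (toℕ ([ index T , index U ]′ (splitAt K t))))
                       (suc (toℕ ([ element T , element U ]′ (splitAt K t))))
    ∈N t with splitAt K t
    ... | inj₁ s = element∈N T s
    ... | inj₂ s = element∈N U s

  transversal⇒independent : ∀ {K X} → Transversal K X →
    ∃ λ I → I ⊆ X × Independent n r P Q I × ∣ I ∣ ≡ K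
  transversal⇒independent {K} {X} T = I , I⊆X , (assign , assign∈N , assign-inj) , ∣I∣≡K
    where
    image = image-of-injection (element T) (element-injective T)
    I = proj₁ image
    ∣I∣≡K = proj₁ (proj₂ image)
    preimage : ∀ {x} → x ∈ I → ∃ λ t → element T t ≡ x
    preimage = proj₂ (proj₂ image)
    assign : ∀ x → x ∈ I → Fin r
    assign x h = index T (proj₁ (preimage h))
    I⊆X : I ⊆ X
    I⊆X h = subst (_∈ X) (proj₂ (preimage h)) (element∈X T _)
    assign∈N : ∀ x h → InN P Q (suc (toℕ (assign x h))) (suc (toℕ x))
    assign∈N x h =
      subst (λ y → InN P Q (suc (toℕ (assign x h))) (suc (toℕ y))) (proj₂ (preimage h)) (element∈N T _)
    assign-inj : ∀ x y hx hy → assign x hx ≡ assign y hy → x ≡ y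
    assign-inj x y hx hy eq = begin
      x                               ≡⟨ proj₂ (preimage hx) ⟨
      element T (proj₁ (preimage hx)) ≡⟨ cong (element T) (index-injective T eq) ⟩
      element T (proj₁ (preimage hy)) ≡⟨ proj₂ (preimage hy) ⟩
      y                               ∎
      where open ≡-Reasoning

module IntervalRank {n r : ℕ} {P Q : List Step}
  (#N[P]≡r : countN P ≡ r) (#N[Q]≡r : countN Q ≡ r) (P≤Q : NeverAbove P Q) where

  open TransversalMatroid {n} {r} P Q

  <r⇒<countN-P : ∀ {i} → i < r → i < countN P
  <r⇒<countN-P {i} = subst (i <_) (sym #N[P]≡r)

  <r⇒<countN-Q : ∀ {i} → i < r → i < countN Q
  <r⇒<countN-Q {i} = subst (i <_) (sym #N[Q]≡r)

  posN-Q≤posN-P : ∀ {i} → i < r → posN Q i ≤ posN P i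
  posN-Q≤posN-P {i} i<r = countN-take≤⇒≤posN P (posN Q i)
    (subst (countN (take (posN Q i) P) ≤_) (countN-take-posN Q (<r⇒<countN-Q i<r)) (P≤Q (posN Q i)))
    (<r⇒<countN-P i<r)

  representative : ℕ → ℕ → ℕ
  representative u s = posN Q (countN (take u P) + s) ⊔ (u + s)

  representative-step : ∀ u s → representative u s < representative u (suc s)
  representative-step u s = ⊔-mono-<
    (StrictlyIncreasing.<-mono (posN-step Q) (+-monoʳ-< (countN (take u P)) ≤-refl))
    (+-monoʳ-< u ≤-refl)

  representative<v : ∀ u v s → countN (take u P) + s < countN (take v Q) → u + s < v →
    representative u s < v
  representative<v u v s c+s<d u+s<v = ⊔-lub (<countN-take⇒posN< Q v c+s<d) u+s<v

  representative∈N : ∀ u s → countN (take u P) + s < r →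
    InN P Q (suc (countN (take u P) + s)) (suc (representative u s))
  representative∈N u s c+s<r = InN-intro P Q (<r⇒<countN-Q c+s<r) (<r⇒<countN-P c+s<r)
    (m≤m⊔n _ _) (⊔-lub (posN-Q≤posN-P c+s<r) u+s≤posN-P)
    where
    c = countN (take u P)
    open ≤-Reasoning
    u+s≤posN-P : u + s ≤ posN P (c + s)
    u+s≤posN-P = begin
      u + s          ≤⟨ +-monoˡ-≤ s (countN-take≤⇒≤posN P u ≤-refl
                                        (<r⇒<countN-P (≤-<-trans (m≤m+n c s) c+s<r))) ⟩
      posN P c + s   ≤⟨ StrictlyIncreasing.+-≤ (posN-step P) c s ⟩
      posN P (c + s) ∎

  interval-transversal : ∀ {X} u v k → v ≤ n → (∀ x → u ≤ toℕ x → toℕ x < v → x ∈ X) →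
    k ≤ countN (take v Q) ∸ countN (take u P) → k ≤ v ∸ u →
    Σ (Transversal k X) λ T → ∀ t → toℕ (index T t) ≡ countN (take u P) + toℕ t
  interval-transversal {X} u v k v≤n interval⊆X k≤d∸c k≤v∸u = transversal , λ _ → toℕ-fromℕ< _
    where
    c = countN (take u P)
    c+t<d : ∀ (t : Fin k) → c + toℕ t < countN (take v Q)
    c+t<d t = <∸⇒+< c (<-≤-trans (toℕ<n t) k≤d∸c)
    c+t<r : ∀ t → c + toℕ t < r
    c+t<r t = <-≤-trans (c+t<d t) (subst (countN (take v Q) ≤_) #N[Q]≡r (countN-take≤countN Q v))
    rep<v : ∀ (t : Fin k) → representative u (toℕ t) < v
    rep<v t = representative<v u v (toℕ t) (c+t<d t) (<∸⇒+< u (<-≤-trans (toℕ<n t) k≤v∸u))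
    transversal : Transversal k X
    transversal = record
      { index             = λ t → fromℕ< (c+t<r t)
      ; element           = λ t → fromℕ< (≤-trans (rep<v t) v≤n)
      ; index-injective   = λ eq → toℕ-injective (+-cancelˡ-≡ c _ _ (Finₚ.fromℕ<-injective _ _ _ _ eq))
      ; element-injective = λ eq → toℕ-injective
          (StrictlyIncreasing.injective (representative-step u) (Finₚ.fromℕ<-injective _ _ _ _ eq))
      ; element∈X         = λ t → interval⊆X _
          (subst (u ≤_) (sym (toℕ-fromℕ< _)) (≤-trans (m≤m+n u (toℕ t)) (m≤n⊔m _ _)))
          (subst (_< v) (sym (toℕ-fromℕ< _)) (rep<v t))
      ; element∈N         = λ t → subst₂ (λ i x → InN P Q (suc i) (suc x))
          (sym (toℕ-fromℕ< _)) (sym (toℕ-fromℕ< _)) (representative∈N u (toℕ t) (c+t<r t))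
      }

  interval-rank : ∀ {X} u v → v ≤ n → (∀ x → x ∈ X ⇔ (u ≤ toℕ x × toℕ x < v)) →
    IsRank n r P Q X ((countN (take v Q) ∸ countN (take u P)) ⊓ (v ∸ u))
  interval-rank {X} u v v≤n ∈X⇔ =
    transversal⇒independent (proj₁ (interval-transversal u v _ v≤n
      (λ x u≤x x<v → Equivalence.from (∈X⇔ x) (u≤x , x<v)) (m⊓n≤m _ _) (m⊓n≤n _ _))) ,
    RankAtMost-⊓ (RankAtMost-indices region) (RankAtMost-elements (Equivalence.to (∈X⇔ _)))
    where
    region : ∀ {x j} → x ∈ X → InN P Q (suc (toℕ j)) (suc (toℕ x)) →
             countN (take u P) ≤ toℕ j × toℕ j < countN (take v Q)
    region {x} {j} x∈X inN with Equivalence.to (∈X⇔ x) x∈X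
    ... | u≤x , x<v = ≮⇒≥ (λ j<c → <⇒≱ (InN⇒< P Q u inN j<c) u≤x) ,
                      InN⇒<countN-take P Q v inN (<r⇒<countN-Q (toℕ<n j)) x<v

m+s≡[n⊓m+s]+[m∸n]⊓t⇔m∸n≤t : ∀ m n s t → (m + s ≡ ((n ⊓ m) + s) + ((m ∸ n) ⊓ t)) ⇔ (m ∸ n ≤ t)
m+s≡[n⊓m+s]+[m∸n]⊓t⇔m∸n≤t m n s t = mk⇔
  (λ eq → subst (_≤ t) (sym (+-cancelˡ-≡ (n ⊓ m + s) _ _ (trans (sym split) eq)))
                       (m⊓n≤n (m ∸ n) t))
  (λ m∸n≤t → trans split (cong (n ⊓ m + s +_) (sym (m≤n⇒m⊓n≡m m∸n≤t))))
  where
  open ≡-Reasoning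
  split : m + s ≡ (n ⊓ m + s) + (m ∸ n)
  split = begin
    m + s                   ≡⟨ cong (_+ s) (m⊓n+n∸m≡n n m) ⟨
    (n ⊓ m + (m ∸ n)) + s   ≡⟨ +-assoc (n ⊓ m) (m ∸ n) s ⟩
    n ⊓ m + ((m ∸ n) + s)   ≡⟨ cong (n ⊓ m +_) (+-comm (m ∸ n) s) ⟩
    n ⊓ m + (s + (m ∸ n))   ≡⟨ +-assoc (n ⊓ m) s (m ∸ n) ⟨
    (n ⊓ m + s) + (m ∸ n)   ∎

p≤m⇒n∸q≤[m+n]∸[p+q] : ∀ m n p q → p ≤ m → n ∸ q ≤ (m + n) ∸ (p + q)
p≤m⇒n∸q≤[m+n]∸[p+q] m       n zero    q z≤n       = ∸-monoˡ-≤ q (m≤n+m n m)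
p≤m⇒n∸q≤[m+n]∸[p+q] (suc m) n (suc p) q (s≤s p≤m) = p≤m⇒n∸q≤[m+n]∸[p+q] m n p q p≤m

m<p⇒q<n⇒[m+n]∸[p+q]<n∸q : ∀ m n p q → m < p → q < n → (m + n) ∸ (p + q) < n ∸ q
m<p⇒q<n⇒[m+n]∸[p+q]<n∸q zero    n (suc p) q _         q<n = begin-strict
  n ∸ suc (p + q)  ≤⟨ ∸-monoʳ-≤ n (s≤s (m≤n+m q p)) ⟩
  n ∸ suc q        <⟨ ∸-monoʳ-< ≤-refl q<n ⟩
  n ∸ q            ∎
  where open ≤-Reasoning
m<p⇒q<n⇒[m+n]∸[p+q]<n∸q (suc m) n (suc p) q (s≤s m<p) q<n = m<p⇒q<n⇒[m+n]∸[p+q]<n∸q m n p q m<p q<n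

n∸q≤[m+n]∸[p+q]⇔¬[m<p×q<n] : ∀ m n p q → (n ∸ q ≤ (m + n) ∸ (p + q)) ⇔ (¬ (m < p × q < n))
n∸q≤[m+n]∸[p+q]⇔¬[m<p×q<n] m n p q = mk⇔
  (λ ≤∸ (m<p , q<n) → <⇒≱ (m<p⇒q<n⇒[m+n]∸[p+q]<n∸q m n p q m<p q<n) ≤∸)
  from
  where
  from : ¬ (m < p × q < n) → n ∸ q ≤ (m + n) ∸ (p + q)
  from ¬mixed with q <? n | p ≤? m
  ... | no  q≮n | _       = subst (_≤ (m + n) ∸ (p + q)) (sym (m≤n⇒m∸n≡0 (≮⇒≥ q≮n))) z≤n
  ... | yes _   | yes p≤m = p≤m⇒n∸q≤[m+n]∸[p+q] m n p q p≤m
  ... | yes q<n | no  p≰m = contradiction (≰⇒> p≰m , q<n) ¬mixed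

module Flats {m r : ℕ} {P Q : List Step}
             (isP : IsPath m r P) (isQ : IsPath m r Q) (P≤Q : NeverAbove P Q)
             (a b' : ℕ) (a≤n : a ≤ m + r) (b'≤n : b' ≤ m + r) where

  n = m + r

  open TransversalMatroid {n} {r} P Q
  open IntervalRank {n} {r} (proj₂ isP) (proj₂ isQ) P≤Q

  A B : Subset n
  A = initSet n a
  B = finalSet n (suc b')

  a₁ a₂ b₁ b₂ : ℕ
  a₁ = countE (take a Q)
  a₂ = countN (take a Q)
  b₁ = countE (take b' P)
  b₂ = countN (take b' P)

  ∈A⇔ : ∀ x → x ∈ A ⇔ toℕ x < a
  ∈A⇔ x = ⇔-trans (∈tabulate⇔ _ x) T[≤ᵇ]⇔≤

  ∈B⇔ : ∀ x → x ∈ B ⇔ b' ≤ toℕ x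
  ∈B⇔ x = ⇔-trans (∈tabulate⇔ _ x) (⇔-trans T[≤ᵇ]⇔≤ (mk⇔ s≤s⁻¹ s≤s))

  #N[take-n-Q]≡r : countN (take n Q) ≡ r
  #N[take-n-Q]≡r = trans (cong countN (take-all n Q (≤-reflexive (IsPath⇒length≡ Q isQ)))) (proj₂ isQ)

  b₂≤r : b₂ ≤ r
  b₂≤r = subst (b₂ ≤_) (proj₂ isP) (countN-take≤countN P b')

  r∸b₂≤n∸b' : r ∸ b₂ ≤ n ∸ b'
  r∸b₂≤n∸b' = subst₂ (λ k l → k ∸ b₂ ≤ l ∸ b') (proj₂ isP) (IsPath⇒length≡ P isP)
                (countN∸countN-take≤length∸ P b')

  rank-A : IsRank n r P Q A a₂
  rank-A = subst (IsRank n r P Q A) (m≤n⇒m⊓n≡m (countN-take≤ Q a))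
    (interval-rank 0 a a≤n λ x →
      mk⇔ (λ x∈A → z≤n , Equivalence.to (∈A⇔ x) x∈A) (Equivalence.from (∈A⇔ x) ∘ proj₂))

  rank-B : IsRank n r P Q B (r ∸ b₂)
  rank-B = subst (IsRank n r P Q B)
    (trans (cong (λ d → (d ∸ b₂) ⊓ (n ∸ b')) #N[take-n-Q]≡r) (m≤n⇒m⊓n≡m r∸b₂≤n∸b'))
    (interval-rank b' n ≤-refl λ x →
      mk⇔ (λ x∈B → Equivalence.to (∈B⇔ x) x∈B , toℕ<n x) (Equivalence.from (∈B⇔ x) ∘ proj₁))

  rank-A∩B : IsRank n r P Q (A ∩ B) ((a₂ ∸ b₂) ⊓ (a ∸ b'))
  rank-A∩B = interval-rank b' a a≤n λ x → mk⇔
    (λ x∈A∩B → let x∈A , x∈B = x∈p∩q⁻ A B x∈A∩B in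
                Equivalence.to (∈B⇔ x) x∈B , Equivalence.to (∈A⇔ x) x∈A)
    (λ (b'≤x , x<a) → x∈p∩q⁺ (Equivalence.from (∈A⇔ x) x<a , Equivalence.from (∈B⇔ x) b'≤x))

  -- The representatives chosen inside A lie before b', because their sets N_(i+1), i < b₂,
  -- end before b'.
  rank-A∪B : IsRank n r P Q (A ∪ B) ((b₂ ⊓ a₂) + (r ∸ b₂))
  rank-A∪B = transversal⇒independent (transversal-∪ T₁ T₂ index-disjoint element-disjoint) ,
             subst (RankAtMost (A ∪ B)) r⊓[a₂+[r∸b₂]]≡
               (RankAtMost-⊓ RankAtMost-r (RankAtMost-∪ (proj₂ rank-A) (proj₂ rank-B)))
    where
    part₁ = interval-transversal 0 a (b₂ ⊓ a₂) a≤n (λ x _ → Equivalence.from (∈A⇔ x))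
              (m⊓n≤n b₂ a₂) (≤-trans (m⊓n≤n b₂ a₂) (countN-take≤ Q a))
    part₂ = interval-transversal b' n (r ∸ b₂) ≤-refl (λ x b'≤x _ → Equivalence.from (∈B⇔ x) b'≤x)
              (≤-reflexive (cong (_∸ b₂) (sym #N[take-n-Q]≡r))) r∸b₂≤n∸b'
    T₁ = proj₁ part₁
    T₂ = proj₁ part₂
    index₁<b₂ : ∀ s → toℕ (index T₁ s) < b₂
    index₁<b₂ s = subst (_< b₂) (sym (proj₂ part₁ s)) (<-≤-trans (toℕ<n s) (m⊓n≤m b₂ a₂))
    index-disjoint : ∀ s t → index T₁ s ≢ index T₂ t
    index-disjoint s t eq = <⇒≱ (index₁<b₂ s)
      (subst (b₂ ≤_) (sym (trans (cong toℕ eq) (proj₂ part₂ t))) (m≤m+n b₂ (toℕ t)))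
    element-disjoint : ∀ s t → element T₁ s ≢ element T₂ t
    element-disjoint s t eq = <⇒≱ (InN⇒< P Q b' (element∈N T₁ s) (index₁<b₂ s))
      (subst (b' ≤_) (sym (cong toℕ eq)) (Equivalence.to (∈B⇔ _) (element∈X T₂ t)))
    r⊓[a₂+[r∸b₂]]≡ : r ⊓ (a₂ + (r ∸ b₂)) ≡ (b₂ ⊓ a₂) + (r ∸ b₂)
    r⊓[a₂+[r∸b₂]]≡ = begin
      r ⊓ (a₂ + (r ∸ b₂))                  ≡⟨ cong (_⊓ (a₂ + (r ∸ b₂))) (m+[n∸m]≡n b₂≤r) ⟨
      (b₂ + (r ∸ b₂)) ⊓ (a₂ + (r ∸ b₂))    ≡⟨ +-distribʳ-⊓ (r ∸ b₂) b₂ a₂ ⟨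
      (b₂ ⊓ a₂) + (r ∸ b₂)                 ∎
      where open ≡-Reasoning

  modular⇔¬mixed : Modular n r P Q A B ⇔ (¬ Mixed P Q a (suc b'))
  modular⇔¬mixed =
    ⇔-trans (modular⇔ rank-A rank-B rank-A∪B rank-A∩B)
            (⇔-trans (m+s≡[n⊓m+s]+[m∸n]⊓t⇔m∸n≤t a₂ b₂ (r ∸ b₂) (a ∸ b')) ≤⇔¬mixed)
    where
    a₁+a₂≡a : a₁ + a₂ ≡ a
    a₁+a₂≡a = countE+countN-take Q a (subst (a ≤_) (sym (IsPath⇒length≡ Q isQ)) a≤n)
    b₁+b₂≡b' : b₁ + b₂ ≡ b'
    b₁+b₂≡b' = countE+countN-take P b' (subst (b' ≤_) (sym (IsPath⇒length≡ P isP)) b'≤n)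
    ≤⇔¬mixed : (a₂ ∸ b₂ ≤ a ∸ b') ⇔ (¬ Mixed P Q a (suc b'))
    ≤⇔¬mixed = subst₂ (λ k l → (a₂ ∸ b₂ ≤ k ∸ l) ⇔ (¬ Mixed P Q a (suc b'))) a₁+a₂≡a b₁+b₂≡b'
                      (n∸q≤[m+n]∸[p+q]⇔¬[m<p×q<n] a₁ a₂ b₁ b₂)

corollary4p2 : (m r : ℕ) (P Q : List Step) →
    IsPath m r P → IsPath m r Q → NeverAbove P Q → MeetOnlyAtEnds P Q →
    (a b : ℕ) → InitialCF Q a → FinalCF P b →
    (Modular (m + r) r P Q (initSet (m + r) a) (finalSet (m + r) b) ⇔ (¬ Mixed P Q a b))
corollary4p2 m r P Q isP isQ P≤Q _ a .(suc b') (q[a]≡E , _) (b' , refl , p[b']≡N , _) =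
  Flats.modular⇔¬mixed isP isQ P≤Q a b'
    (subst (a ≤_) (IsPath⇒length≡ Q isQ) (nth≡just⇒≤length Q a q[a]≡E))
    (subst (b' ≤_) (IsPath⇒length≡ P isP) (nth≡just⇒≤length P b' p[b']≡N))
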